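{- For every integer $n\ge 1$, the Catalan number $C_n=\frac{1}{n+1}\binom{2n}{n}$ equals the number of ordered pairs $(P,Q)$ of Dyck paths of total semilength $n$ (i.e. the semilengths of $P$ and $Q$ sum to $n$) such that $P$ is nonempty and $h(P)\le h(Q)+1$.
   Context: Paths use steps $(1,1)$ (up steps) and $(1,-1)$ (down steps). The level of a point is its $y$-coordinate. A Dyck path of semilength $n$ is such a path starting at $(0,0)$, ending at $(2n,0)$, and never going below level $0$; the empty path is the Dyck path of semilength $0$. The height $h(P)$ of a path $P$ is the highest level it reaches (so the empty path has height $0$). -}

module Defs where

open import Data.Nat using (ℕ; zero; suc; _+_; _*_; _⊔_; _≤_)
open import Data.Nat.DivMod using (_/_)
open import Data.Nat.Combinatorics using (_C_)
open import Data.Bool using (Bool; true; false)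
open import Data.List using (List; []; _∷_; length)
open import Data.Product using (Σ; _×_)
open import Relation.Binary.PropositionalEquality using (_≡_)

data Step : Set where
  U D : Step

-- dyckFrom k s = true iff the path s, started at level k, never goes
-- below level 0 and ends at level 0.
dyckFrom : ℕ → List Step → Bool
dyckFrom zero    []      = true
dyckFrom (suc k) []      = false
dyckFrom k       (U ∷ s) = dyckFrom (suc k) s
dyckFrom zero    (D ∷ s) = false
dyckFrom (suc k) (D ∷ s) = dyckFrom k s

IsDyck : ℕ → List Step → Set
IsDyck n s = (length s ≡ 2 * n) × (dyckFrom 0 s ≡ true)

DyckPath : ℕ → Set
DyckPath n = Σ (List Step) (IsDyck n)

-- heightFrom k s = highest level reached by s when started at level k
-- (levels are clamped at 0, which is irrelevant for Dyck paths).
heightFrom : ℕ → List Step → ℕ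
heightFrom k []            = k
heightFrom k (U ∷ s)       = k ⊔ heightFrom (suc k) s
heightFrom zero (D ∷ s)    = heightFrom zero s
heightFrom (suc k) (D ∷ s) = suc k ⊔ heightFrom k s

height : List Step → ℕ
height = heightFrom 0

catalan : ℕ → ℕ
catalan n = ((2 * n) C n) / suc n

GoodPair : ℕ → Set
GoodPair n =
  Σ ℕ λ a → Σ ℕ λ b →
    (a + b ≡ n) × Σ (DyckPath a) λ P → Σ (DyckPath b) λ Q →
      (1 ≤ a) × (height (Data.Product.proj₁ P) ≤ suc (height (Data.Product.proj₁ Q)))

module Submission where

-- Dyck paths are ballot paths from level 0, and by the reflection principle
-- there are (2n C n) - (2n C (n - 1)) = C_n of them. A nonempty Dyck path
-- factors uniquely into prime paths U S D; let U Q D be the first factor that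
-- reaches the height of the whole path, so the path reads A U Q D R with every
-- factor of A strictly lower than U Q D and R at most as high. Sending it to
-- (U A D R, Q) is the bijection: h(U A D R) ≤ h(Q) + 1 says exactly that U Q D
-- is the first highest factor of A U Q D R. Paths are handled as binary trees,
-- node S B standing for U S D B.

open import Defs
open import Data.Nat using (ℕ; zero; suc; _+_; _*_; _∸_; _⊔_; _≤_; _<_; z≤n; s≤s; s≤s⁻¹)
open import Data.List.Properties using (length-++; ++-assoc; ++-identityʳ; ∷-injectiveʳ)
open import Data.Nat.Properties
open import Data.Nat.Combinatorics
  using (_C_; nCn≡1; nC1≡n; nCk≡nC[n∸k]; k>n⇒nCk≡0; nCk+nC[k+1]≡[n+1]C[k+1])
open import Algebra.Properties.CommutativeSemigroup +-commutativeSemigroup using (interchange)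
open import Data.Nat.DivMod using (_/_; m*n/n≡m)
open import Data.Nat.Tactic.RingSolver using (solve-∀)
open import Data.Bool using (Bool; true)
import Data.Bool.Properties as Bool
open import Data.List using (List; []; _∷_; length; _++_)
open import Data.Product using (Σ; _×_; _,_; proj₁; proj₂; map₁; uncurry)
open import Data.Empty using (⊥-elim)
open import Data.Sum using (_⊎_; inj₁; inj₂)
open import Data.Sum.Function.Propositional using (_⊎-↔_)
open import Data.Fin using (Fin; zero)
open import Data.Fin.Properties using (+↔⊎)
open import Axiom.UniquenessOfIdentityProofs using (module Decidable⇒UIP)
open import Function.Bundles using (_↔_; mk↔ₛ′; _⇔_; mk⇔; module Equivalence)
open import Function.Properties.Inverse using (↔-trans; ↔-sym)
open import Relation.Binary.PropositionalEquality
open import Relation.Nullary using (yes; no)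

ballot : ℕ → ℕ → ℕ
ballot zero    zero    = 1
ballot (suc k) zero    = 0
ballot zero    (suc L) = ballot 1 L
ballot (suc k) (suc L) = ballot (suc (suc k)) L + ballot k L

BallotPath : ℕ → ℕ → Set
BallotPath k L = Σ (List Step) λ s → length s ≡ L × dyckFrom k s ≡ true

Bool-≡-irrelevant : {a b : Bool} (p q : a ≡ b) → p ≡ q
Bool-≡-irrelevant = Decidable⇒UIP.≡-irrelevant Bool._≟_

BallotPath-ext : ∀ k L {p q : BallotPath k L} → proj₁ p ≡ proj₁ q → p ≡ q
BallotPath-ext _ _ {s , l , d} {.s , l′ , d′} refl =
  cong₂ (λ l d → s , l , d) (≡-irrelevant l l′) (Bool-≡-irrelevant d d′)

BallotPath↔Fin : ∀ k L → BallotPath k L ↔ Fin (ballot k L)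
BallotPath↔Fin zero zero = mk↔ₛ′ (λ _ → zero) (λ _ → [] , refl , refl) (λ { zero → refl }) from∘to
  where
  from∘to : ∀ p → ([] , refl , refl) ≡ p
  from∘to ([] , _ , _) = BallotPath-ext 0 0 refl
BallotPath↔Fin (suc k) zero = mk↔ₛ′ (λ { ([] , _ , ()) }) (λ ()) (λ ()) (λ { ([] , _ , ()) })
BallotPath↔Fin zero (suc L) =
  ↔-trans (mk↔ₛ′ to from (λ _ → BallotPath-ext 1 L refl) from∘to) (BallotPath↔Fin 1 L)
  where
  to : BallotPath 0 (suc L) → BallotPath 1 L
  to (U ∷ s , l , d) = s , suc-injective l , d
  from : BallotPath 1 L → BallotPath 0 (suc L)
  from (s , l , d) = U ∷ s , cong suc l , d
  from∘to : ∀ p → from (to p) ≡ p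
  from∘to (U ∷ s , _ , _) = BallotPath-ext 0 (suc L) refl
BallotPath↔Fin (suc k) (suc L) =
  ↔-trans (mk↔ₛ′ to from to∘from from∘to)
  (↔-trans (BallotPath↔Fin (suc (suc k)) L ⊎-↔ BallotPath↔Fin k L) (↔-sym +↔⊎))
  where
  to : BallotPath (suc k) (suc L) → BallotPath (suc (suc k)) L ⊎ BallotPath k L
  to (U ∷ s , l , d) = inj₁ (s , suc-injective l , d)
  to (D ∷ s , l , d) = inj₂ (s , suc-injective l , d)
  from : BallotPath (suc (suc k)) L ⊎ BallotPath k L → BallotPath (suc k) (suc L)
  from (inj₁ (s , l , d)) = U ∷ s , cong suc l , d
  from (inj₂ (s , l , d)) = D ∷ s , cong suc l , d
  to∘from : ∀ p → to (from p) ≡ p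
  to∘from (inj₁ _) = cong inj₁ (BallotPath-ext (suc (suc k)) L refl)
  to∘from (inj₂ _) = cong inj₂ (BallotPath-ext k L refl)
  from∘to : ∀ p → from (to p) ≡ p
  from∘to (U ∷ _ , _ , _) = BallotPath-ext (suc k) (suc L) refl
  from∘to (D ∷ _ , _ , _) = BallotPath-ext (suc k) (suc L) refl

ballot-< : ∀ {k L} → L < k → ballot k L ≡ 0
ballot-< {suc k} {zero}  _         = refl
ballot-< {suc k} {suc L} (s≤s L<k) =
  cong₂ _+_ (ballot-< (m<n⇒m<1+n (m<n⇒m<1+n L<k))) (ballot-< L<k)

ballot-diag : ∀ k → ballot k k ≡ 1
ballot-diag zero    = refl
ballot-diag (suc k) = cong₂ _+_ (ballot-< (m<n⇒m<1+n (n<1+n k))) (ballot-diag k)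

nC0≡1 : ∀ n → n C 0 ≡ 1
nC0≡1 n = trans (nCk≡nC[n∸k] {n = n} (z≤n {n})) (nCn≡1 n)

nCk*[n∸k]≡nC[k+1]*[k+1] : ∀ n k → (n C k) * (n ∸ k) ≡ (n C suc k) * suc k
nCk*[n∸k]≡nC[k+1]*[k+1] zero k = begin
  (0 C k) * (0 ∸ k)    ≡⟨ cong ((0 C k) *_) (0∸n≡0 k) ⟩
  (0 C k) * 0          ≡⟨ *-zeroʳ (0 C k) ⟩
  0                    ≡⟨ cong (_* suc k) (k>n⇒nCk≡0 {0} {suc k} (s≤s z≤n)) ⟨
  (0 C suc k) * suc k  ∎
  where open ≡-Reasoning
nCk*[n∸k]≡nC[k+1]*[k+1] (suc n) zero = begin
  (suc n C 0) * suc n  ≡⟨ cong (_* suc n) (nC0≡1 (suc n)) ⟩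
  1 * suc n            ≡⟨ *-comm 1 (suc n) ⟩
  suc n * 1            ≡⟨ cong (_* 1) (nC1≡n (suc n)) ⟨
  (suc n C 1) * 1      ∎
  where open ≡-Reasoning
nCk*[n∸k]≡nC[k+1]*[k+1] (suc n) (suc k) with k <? n
... | yes k<n = begin
  (suc n C suc k) * (n ∸ k)           ≡⟨ cong₂ _*_ (pascal k) (sym n∸k≡1+d) ⟨
  (a + b) * suc d                     ≡⟨ *-distribʳ-+ (suc d) a b ⟩
  a * suc d + b * suc d               ≡⟨ cong (_+ b * suc d) IH₁ ⟩
  b * suc k + b * suc d               ≡⟨ move-one b k d ⟩
  b * suc (suc k) + b * d             ≡⟨ cong (b * suc (suc k) +_) IH₂ ⟩
  b * suc (suc k) + c * suc (suc k)   ≡⟨ *-distribʳ-+ (suc (suc k)) b c ⟨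
  (b + c) * suc (suc k)               ≡⟨ cong (_* suc (suc k)) (pascal (suc k)) ⟩
  (suc n C suc (suc k)) * suc (suc k) ∎
  where
  open ≡-Reasoning
  a = n C k
  b = n C suc k
  c = n C suc (suc k)
  d = n ∸ suc k
  pascal : ∀ k → n C k + n C suc k ≡ suc n C suc k
  pascal = nCk+nC[k+1]≡[n+1]C[k+1] n
  move-one : ∀ x y z → x * suc y + x * suc z ≡ x * suc (suc y) + x * z
  move-one = solve-∀
  n∸k≡1+d : n ∸ k ≡ suc d
  n∸k≡1+d = +-∸-assoc 1 k<n
  IH₁ : a * suc d ≡ b * suc k
  IH₁ = trans (cong (a *_) (sym n∸k≡1+d)) (nCk*[n∸k]≡nC[k+1]*[k+1] n k)
  IH₂ : b * d ≡ c * suc (suc k)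
  IH₂ = nCk*[n∸k]≡nC[k+1]*[k+1] n (suc k)
... | no k≮n = begin
  (suc n C suc k) * (n ∸ k)            ≡⟨ cong ((suc n C suc k) *_) (m≤n⇒m∸n≡0 n≤k) ⟩
  (suc n C suc k) * 0                  ≡⟨ *-zeroʳ (suc n C suc k) ⟩
  0                                    ≡⟨ cong (_* suc (suc k)) (k>n⇒nCk≡0 (s≤s (s≤s n≤k))) ⟨
  (suc n C suc (suc k)) * suc (suc k)  ∎
  where
  open ≡-Reasoning
  n≤k : n ≤ k
  n≤k = ≮⇒≥ k≮n

-- n C (k - 1), except that the value at k = 0 is 0 rather than n C 0.
_C[_-1] : ℕ → ℕ → ℕ
n C[ zero  -1] = 0
n C[ suc k -1] = n C k

[1+n]Ck≡nC[k-1]+nCk : ∀ n k → suc n C k ≡ n C[ k -1] + n C k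
[1+n]Ck≡nC[k-1]+nCk n zero    = trans (nC0≡1 (suc n)) (sym (nC0≡1 n))
[1+n]Ck≡nC[k-1]+nCk n (suc k) = sym (nCk+nC[k+1]≡[n+1]C[k+1] n k)

[1+2n]Cn≡[1+2n]C[1+n] : ∀ n → suc (2 * n) C n ≡ suc (2 * n) C suc n
[1+2n]Cn≡[1+2n]C[1+n] n = begin
  suc (2 * n) C n                  ≡⟨ nCk≡nC[n∸k] (m≤n⇒m≤1+n (m≤m+n n (n + 0))) ⟩
  suc (2 * n) C (suc (2 * n) ∸ n)  ≡⟨ cong (λ m → suc (2 * n) C (m ∸ n)) (1+2n≡n+[1+n] n) ⟩
  suc (2 * n) C (n + suc n ∸ n)    ≡⟨ cong (suc (2 * n) C_) (m+n∸m≡n n (suc n)) ⟩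
  suc (2 * n) C suc n              ∎
  where
  open ≡-Reasoning
  1+2n≡n+[1+n] : ∀ n → suc (2 * n) ≡ n + suc n
  1+2n≡n+[1+n] = solve-∀

-- The reflection principle: of the L C j paths with j up steps from level k
-- to level 0, those that dip below 0 correspond, by reflecting the part before
-- their first visit to -1, to the L C (j - 1) paths from level k to level -2.
ballot-reflection : ∀ L k j → k + 2 * j ≡ L → ballot k L + L C[ j -1] ≡ L C j
ballot-reflection L k zero k+0≡L = begin
  ballot k L + 0   ≡⟨ +-identityʳ (ballot k L) ⟩
  ballot k L       ≡⟨ cong (λ m → ballot m L) k≡L ⟩
  ballot L L       ≡⟨ ballot-diag L ⟩
  1                ≡⟨ nC0≡1 L ⟨
  L C 0            ∎
  where
  open ≡-Reasoning
  k≡L : k ≡ L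
  k≡L = trans (sym (+-identityʳ k)) k+0≡L
ballot-reflection zero k (suc j) eq with () ← trans (sym (+-suc k _)) eq
ballot-reflection (suc L) zero (suc j) eq = begin
  ballot 1 L + suc L C j                ≡⟨ cong (ballot 1 L +_) ([1+n]Ck≡nC[k-1]+nCk L j) ⟩
  ballot 1 L + (L C[ j -1] + L C j)     ≡⟨ +-assoc (ballot 1 L) _ _ ⟨
  (ballot 1 L + L C[ j -1]) + L C j     ≡⟨ cong (_+ L C j) (ballot-reflection L 1 j 1+2j≡L) ⟩
  L C j + L C j                         ≡⟨ cong (L C j +_) LCj≡LC[1+j] ⟩
  L C j + L C suc j                     ≡⟨ nCk+nC[k+1]≡[n+1]C[k+1] L j ⟩
  suc L C suc j                         ∎
  where
  open ≡-Reasoning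
  1+2j≡L : 1 + 2 * j ≡ L
  1+2j≡L = trans (sym (+-suc j (j + 0))) (suc-injective eq)
  LCj≡LC[1+j] : L C j ≡ L C suc j
  LCj≡LC[1+j] = subst (λ m → m C j ≡ m C suc j) 1+2j≡L ([1+2n]Cn≡[1+2n]C[1+n] j)
ballot-reflection (suc L) (suc k) (suc j) eq = begin
  (ballot (2 + k) L + ballot k L) + suc L C j
    ≡⟨ cong (ballot (2 + k) L + ballot k L +_) ([1+n]Ck≡nC[k-1]+nCk L j) ⟩
  (ballot (2 + k) L + ballot k L) + (L C[ j -1] + L C j)
    ≡⟨ interchange (ballot (2 + k) L) (ballot k L) (L C[ j -1]) (L C j) ⟩
  (ballot (2 + k) L + L C[ j -1]) + (ballot k L + L C j)
    ≡⟨ cong₂ _+_ (ballot-reflection L (2 + k) j 2+k+2j≡L) (ballot-reflection L k (suc j) k+2[1+j]≡L) ⟩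
  L C j + L C suc j
    ≡⟨ nCk+nC[k+1]≡[n+1]C[k+1] L j ⟩
  suc L C suc j
    ∎
  where
  open ≡-Reasoning
  k+2[1+j]≡L : k + 2 * suc j ≡ L
  k+2[1+j]≡L = suc-injective eq
  regroup : ∀ k j → 2 + k + 2 * j ≡ k + 2 * suc j
  regroup = solve-∀
  2+k+2j≡L : 2 + k + 2 * j ≡ L
  2+k+2j≡L = trans (regroup k j) k+2[1+j]≡L

ballot-catalan : ∀ n → ballot 0 (2 * n) * suc n ≡ (2 * n) C n
ballot-catalan zero    = refl
ballot-catalan n@(suc m) = +-cancelʳ-≡ (Y * n) _ _ (begin
  B * suc n + Y * n           ≡⟨ cong (B * suc n +_) absorption ⟨
  B * suc n + X * suc n       ≡⟨ *-distribʳ-+ (suc n) B X ⟨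
  (B + X) * suc n             ≡⟨ cong (_* suc n) (ballot-reflection (2 * n) 0 n refl) ⟩
  Y * suc n                   ≡⟨ *-suc Y n ⟩
  Y + Y * n                   ∎)
  where
  open ≡-Reasoning
  B = ballot 0 (2 * n)
  X = (2 * n) C m
  Y = (2 * n) C n
  regroup : ∀ m → 2 * suc m ≡ m + suc (suc m)
  regroup = solve-∀
  2n∸m≡1+n : 2 * n ∸ m ≡ suc n
  2n∸m≡1+n = trans (cong (_∸ m) (regroup m)) (m+n∸m≡n m (suc n))
  absorption : X * suc n ≡ Y * n
  absorption = trans (cong (X *_) (sym 2n∸m≡1+n)) (nCk*[n∸k]≡nC[k+1]*[k+1] (2 * n) m)

catalan≡ballot : ∀ n → catalan n ≡ ballot 0 (2 * n)
catalan≡ballot n = trans (cong (_/ suc n) (sym (ballot-catalan n))) (m*n/n≡m (ballot 0 (2 * n)) (suc n))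

Fin-catalan↔DyckPath : ∀ n → Fin (catalan n) ↔ DyckPath n
Fin-catalan↔DyckPath n =
  subst (λ m → Fin m ↔ DyckPath n) (sym (catalan≡ballot n)) (↔-sym (BallotPath↔Fin 0 (2 * n)))

data Tree : Set where
  leaf : Tree
  node : Tree → Tree → Tree

size : Tree → ℕ
size leaf       = 0
size (node a b) = suc (size a + size b)

treeHeight : Tree → ℕ
treeHeight leaf       = 0
treeHeight (node a b) = suc (treeHeight a) ⊔ treeHeight b

toPath : Tree → List Step
toPath leaf       = []
toPath (node a b) = U ∷ toPath a ++ D ∷ toPath b

length-toPath : ∀ t → length (toPath t) ≡ 2 * size t
length-toPath leaf       = refl
length-toPath (node a b) = begin
  suc (length (toPath a ++ D ∷ toPath b))
    ≡⟨ cong suc (length-++ (toPath a)) ⟩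
  suc (length (toPath a) + suc (length (toPath b)))
    ≡⟨ cong₂ (λ x y → suc (x + suc y)) (length-toPath a) (length-toPath b) ⟩
  suc (2 * size a + suc (2 * size b))
    ≡⟨ regroup (size a) (size b) ⟩
  2 * suc (size a + size b)
    ∎
  where
  open ≡-Reasoning
  regroup : ∀ x y → suc (2 * x + suc (2 * y)) ≡ 2 * suc (x + y)
  regroup = solve-∀

dyckFrom-U∷ : ∀ k s → dyckFrom k (U ∷ s) ≡ dyckFrom (suc k) s
dyckFrom-U∷ zero    s = refl
dyckFrom-U∷ (suc k) s = refl

dyckFrom-toPath-++ : ∀ t k s → dyckFrom k (toPath t ++ s) ≡ dyckFrom k s
dyckFrom-toPath-++ leaf       k s = refl
dyckFrom-toPath-++ (node a b) k s = begin
  dyckFrom k (U ∷ (toPath a ++ D ∷ toPath b) ++ s)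
    ≡⟨ dyckFrom-U∷ k _ ⟩
  dyckFrom (suc k) ((toPath a ++ D ∷ toPath b) ++ s)
    ≡⟨ cong (dyckFrom (suc k)) (++-assoc (toPath a) (D ∷ toPath b) s) ⟩
  dyckFrom (suc k) (toPath a ++ D ∷ toPath b ++ s)
    ≡⟨ dyckFrom-toPath-++ a (suc k) _ ⟩
  dyckFrom k (toPath b ++ s)
    ≡⟨ dyckFrom-toPath-++ b k s ⟩
  dyckFrom k s
    ∎
  where open ≡-Reasoning

dyckFrom-toPath : ∀ t → dyckFrom 0 (toPath t) ≡ true
dyckFrom-toPath t = trans (cong (dyckFrom 0) (sym (++-identityʳ (toPath t)))) (dyckFrom-toPath-++ t 0 [])

dyckPathOf : (t : Tree) → DyckPath (size t)
dyckPathOf t = toPath t , length-toPath t , dyckFrom-toPath t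

k≤heightFrom : ∀ k s → k ≤ heightFrom k s
k≤heightFrom k       []      = ≤-refl
k≤heightFrom k       (U ∷ s) = m≤m⊔n k (heightFrom (suc k) s)
k≤heightFrom zero    (D ∷ s) = z≤n
k≤heightFrom (suc k) (D ∷ s) = m≤m⊔n (suc k) (heightFrom k s)

heightFrom-toPath-++ : ∀ t k s → heightFrom k (toPath t ++ s) ≡ (k + treeHeight t) ⊔ heightFrom k s
heightFrom-toPath-++ leaf k s = begin
  heightFrom k s             ≡⟨ m≤n⇒m⊔n≡n (k≤heightFrom k s) ⟨
  k ⊔ heightFrom k s         ≡⟨ cong (_⊔ heightFrom k s) (+-identityʳ k) ⟨
  (k + 0) ⊔ heightFrom k s   ∎
  where open ≡-Reasoning
heightFrom-toPath-++ (node a b) k s = begin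
  k ⊔ heightFrom (suc k) ((toPath a ++ D ∷ toPath b) ++ s)
    ≡⟨ cong (λ x → k ⊔ heightFrom (suc k) x) (++-assoc (toPath a) (D ∷ toPath b) s) ⟩
  k ⊔ heightFrom (suc k) (toPath a ++ D ∷ toPath b ++ s)
    ≡⟨ cong (k ⊔_) (heightFrom-toPath-++ a (suc k) _) ⟩
  k ⊔ (ha ⊔ (suc k ⊔ heightFrom k (toPath b ++ s)))
    ≡⟨ cong (λ x → k ⊔ (ha ⊔ (suc k ⊔ x))) (heightFrom-toPath-++ b k s) ⟩
  k ⊔ (ha ⊔ (suc k ⊔ (hb ⊔ H)))
    ≡⟨ m≤n⇒m⊔n≡n (≤-trans (n≤1+n k) (≤-trans 1+k≤ha (m≤m⊔n ha (suc k ⊔ (hb ⊔ H))))) ⟩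
  ha ⊔ (suc k ⊔ (hb ⊔ H))
    ≡⟨ ⊔-assoc ha (suc k) (hb ⊔ H) ⟨
  (ha ⊔ suc k) ⊔ (hb ⊔ H)
    ≡⟨ cong (_⊔ (hb ⊔ H)) (m≥n⇒m⊔n≡m 1+k≤ha) ⟩
  ha ⊔ (hb ⊔ H)
    ≡⟨ ⊔-assoc ha hb H ⟨
  (ha ⊔ hb) ⊔ H
    ≡⟨ cong (λ x → (x ⊔ hb) ⊔ H) (+-suc k (treeHeight a)) ⟨
  ((k + suc (treeHeight a)) ⊔ hb) ⊔ H
    ≡⟨ cong (_⊔ H) (+-distribˡ-⊔ k (suc (treeHeight a)) (treeHeight b)) ⟨
  (k + treeHeight (node a b)) ⊔ H
    ∎
  where
  open ≡-Reasoning
  H  = heightFrom k s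
  ha = suc k + treeHeight a
  hb = k + treeHeight b
  1+k≤ha : suc k ≤ ha
  1+k≤ha = m≤m+n (suc k) (treeHeight a)

height-toPath : ∀ t → height (toPath t) ≡ treeHeight t
height-toPath t = begin
  heightFrom 0 (toPath t)        ≡⟨ cong (heightFrom 0) (++-identityʳ (toPath t)) ⟨
  heightFrom 0 (toPath t ++ [])  ≡⟨ heightFrom-toPath-++ t 0 [] ⟩
  treeHeight t ⊔ 0               ≡⟨ ⊔-identityʳ (treeHeight t) ⟩
  treeHeight t                   ∎
  where open ≡-Reasoning

beforeExit : ℕ → List Step → List Step
beforeExit k       []      = []
beforeExit k       (U ∷ s) = U ∷ beforeExit (suc k) s
beforeExit zero    (D ∷ s) = []
beforeExit (suc k) (D ∷ s) = D ∷ beforeExit k s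

afterExit : ℕ → List Step → List Step
afterExit k       []      = []
afterExit k       (U ∷ s) = afterExit (suc k) s
afterExit zero    (D ∷ s) = s
afterExit (suc k) (D ∷ s) = afterExit k s

exit-decomposition : ∀ k j s → dyckFrom (suc (k + j)) s ≡ true →
  s ≡ beforeExit k s ++ D ∷ afterExit k s
  × dyckFrom k (beforeExit k s) ≡ true × dyckFrom j (afterExit k s) ≡ true
exit-decomposition k       j (U ∷ s) dyck
  with s≡ , dyck₁ , dyck₂ ← exit-decomposition (suc k) j s dyck
  = cong (U ∷_) s≡ , trans (dyckFrom-U∷ k _) dyck₁ , dyck₂
exit-decomposition zero    j (D ∷ s) dyck = refl , refl , dyck
exit-decomposition (suc k) j (D ∷ s) dyck
  with s≡ , dyck₁ , dyck₂ ← exit-decomposition k j s dyck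
  = cong (D ∷_) s≡ , dyck₁ , dyck₂

beforeExit-toPath-++ : ∀ t k s → beforeExit k (toPath t ++ s) ≡ toPath t ++ beforeExit k s
beforeExit-toPath-++ leaf       k s = refl
beforeExit-toPath-++ (node a b) k s = cong (U ∷_) (begin
  beforeExit (suc k) ((toPath a ++ D ∷ toPath b) ++ s)  ≡⟨ cong (beforeExit (suc k)) (++-assoc (toPath a) _ s) ⟩
  beforeExit (suc k) (toPath a ++ D ∷ toPath b ++ s)    ≡⟨ beforeExit-toPath-++ a (suc k) _ ⟩
  toPath a ++ D ∷ beforeExit k (toPath b ++ s)          ≡⟨ cong (λ x → toPath a ++ D ∷ x) (beforeExit-toPath-++ b k s) ⟩
  toPath a ++ D ∷ toPath b ++ beforeExit k s            ≡⟨ ++-assoc (toPath a) _ (beforeExit k s) ⟨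
  (toPath a ++ D ∷ toPath b) ++ beforeExit k s          ∎)
  where open ≡-Reasoning

afterExit-toPath-++ : ∀ t k s → afterExit k (toPath t ++ s) ≡ afterExit k s
afterExit-toPath-++ leaf       k s = refl
afterExit-toPath-++ (node a b) k s = begin
  afterExit (suc k) ((toPath a ++ D ∷ toPath b) ++ s)  ≡⟨ cong (afterExit (suc k)) (++-assoc (toPath a) _ s) ⟩
  afterExit (suc k) (toPath a ++ D ∷ toPath b ++ s)    ≡⟨ afterExit-toPath-++ a (suc k) _ ⟩
  afterExit k (toPath b ++ s)                          ≡⟨ afterExit-toPath-++ b k s ⟩
  afterExit k s                                        ∎
  where open ≡-Reasoning

toPath-injective : ∀ t t′ → toPath t ≡ toPath t′ → t ≡ t′
toPath-injective leaf       leaf         _  = refl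
toPath-injective (node a b) (node a′ b′) eq = cong₂ node
  (toPath-injective a a′ (begin
    toPath a                                   ≡⟨ before a b ⟨
    beforeExit 0 (toPath a ++ D ∷ toPath b)    ≡⟨ cong (beforeExit 0) (∷-injectiveʳ eq) ⟩
    beforeExit 0 (toPath a′ ++ D ∷ toPath b′)  ≡⟨ before a′ b′ ⟩
    toPath a′                                  ∎))
  (toPath-injective b b′ (begin
    toPath b                                   ≡⟨ afterExit-toPath-++ a 0 _ ⟨
    afterExit 0 (toPath a ++ D ∷ toPath b)     ≡⟨ cong (afterExit 0) (∷-injectiveʳ eq) ⟩
    afterExit 0 (toPath a′ ++ D ∷ toPath b′)   ≡⟨ afterExit-toPath-++ a′ 0 _ ⟩
    toPath b′                                  ∎))
  where
  open ≡-Reasoning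
  before : ∀ a b → beforeExit 0 (toPath a ++ D ∷ toPath b) ≡ toPath a
  before a b = trans (beforeExit-toPath-++ a 0 _) (++-identityʳ (toPath a))

toTree : ℕ → List Step → Tree
toTree zero    _       = leaf
toTree (suc f) []      = leaf
toTree (suc f) (U ∷ s) = node (toTree f (beforeExit 0 s)) (toTree f (afterExit 0 s))
toTree (suc f) (D ∷ s) = leaf

toPath-toTree : ∀ f s → length s ≤ f → dyckFrom 0 s ≡ true → toPath (toTree f s) ≡ s
toPath-toTree zero    []      _         _    = refl
toPath-toTree (suc f) []      _         _    = refl
toPath-toTree (suc f) (U ∷ s) (s≤s ∣s∣≤f) dyck
  with s≡ , dyck₁ , dyck₂ ← exit-decomposition 0 0 s dyck
  = cong (U ∷_) (trans
      (cong₂ (λ x y → x ++ D ∷ y) (toPath-toTree f s₁ ∣s₁∣≤f dyck₁) (toPath-toTree f s₂ ∣s₂∣≤f dyck₂))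
      (sym s≡))
  where
  s₁ = beforeExit 0 s
  s₂ = afterExit 0 s
  ∣s∣≡ : length s ≡ length s₁ + suc (length s₂)
  ∣s∣≡ = trans (cong length s≡) (length-++ s₁)
  ∣s₁∣≤f : length s₁ ≤ f
  ∣s₁∣≤f = begin
    length s₁                       ≤⟨ m≤m+n (length s₁) _ ⟩
    length s₁ + suc (length s₂)     ≡⟨ ∣s∣≡ ⟨
    length s                        ≤⟨ ∣s∣≤f ⟩
    f                               ∎
    where open ≤-Reasoning
  ∣s₂∣≤f : length s₂ ≤ f
  ∣s₂∣≤f = begin
    length s₂                       ≤⟨ n≤1+n (length s₂) ⟩
    suc (length s₂)                 ≤⟨ m≤n+m _ (length s₁) ⟩
    length s₁ + suc (length s₂)     ≡⟨ ∣s∣≡ ⟨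
    length s                        ≤⟨ ∣s∣≤f ⟩
    f                               ∎
    where open ≤-Reasoning

pathTree : List Step → Tree
pathTree s = toTree (length s) s

toPath-pathTree : ∀ s → dyckFrom 0 s ≡ true → toPath (pathTree s) ≡ s
toPath-pathTree s = toPath-toTree (length s) s ≤-refl

pathTree-toPath : ∀ t → pathTree (toPath t) ≡ t
pathTree-toPath t = toPath-injective _ _ (toPath-pathTree (toPath t) (dyckFrom-toPath t))

height-pathTree : ∀ s → dyckFrom 0 s ≡ true → treeHeight (pathTree s) ≡ height s
height-pathTree s dyck = trans (sym (height-toPath (pathTree s))) (cong height (toPath-pathTree s dyck))

size-pathTree : ∀ n s → IsDyck n s → size (pathTree s) ≡ n
size-pathTree n s (∣s∣≡2n , dyck) = *-cancelˡ-≡ _ _ 2 (begin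
  2 * size (pathTree s)          ≡⟨ length-toPath (pathTree s) ⟨
  length (toPath (pathTree s))   ≡⟨ cong length (toPath-pathTree s dyck) ⟩
  length s                       ≡⟨ ∣s∣≡2n ⟩
  2 * n                          ∎)
  where open ≡-Reasoning

1≤size-pathTree : ∀ n s → IsDyck n s → 1 ≤ n → 1 ≤ size (pathTree s)
1≤size-pathTree n s isDyck = subst (1 ≤_) (sym (size-pathTree n s isDyck))

infixr 5 _⊕_

-- Concatenation of paths: toPath (x ⊕ y) ≡ toPath x ++ toPath y.
_⊕_ : Tree → Tree → Tree
leaf     ⊕ y = y
node a b ⊕ y = node a (b ⊕ y)

size-⊕ : ∀ x y → size (x ⊕ y) ≡ size x + size y
size-⊕ leaf       y = refl
size-⊕ (node a b) y =
  cong suc (trans (cong (size a +_) (size-⊕ b y)) (sym (+-assoc (size a) (size b) (size y))))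

treeHeight-⊕ : ∀ x y → treeHeight (x ⊕ y) ≡ treeHeight x ⊔ treeHeight y
treeHeight-⊕ leaf       y = refl
treeHeight-⊕ (node a b) y = trans (cong (suc (treeHeight a) ⊔_) (treeHeight-⊕ b y))
                                  (sym (⊔-assoc (suc (treeHeight a)) (treeHeight b) (treeHeight y)))

recombine : Tree × Tree × Tree → Tree
recombine (A , Q , R) = A ⊕ node Q R

-- The factor U Q D of the path A U Q D R is the first of its prime factors
-- that reaches the height of the whole path.
Marked : Tree × Tree × Tree → Set
Marked (A , Q , R) = treeHeight A ≤ treeHeight Q × treeHeight R ≤ suc (treeHeight Q)

Marked-node : ∀ S A Q R → Marked (node S A , Q , R) → suc (treeHeight S) ≤ treeHeight Q × Marked (A , Q , R)
Marked-node S A Q R (h[SA]≤hQ , hR≤1+hQ) =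
    m⊔n≤o⇒m≤o (suc (treeHeight S)) (treeHeight A) h[SA]≤hQ
  , m⊔n≤o⇒n≤o (suc (treeHeight S)) (treeHeight A) h[SA]≤hQ
  , hR≤1+hQ

mark : Tree → Tree × Tree × Tree
mark leaf       = leaf , leaf , leaf
mark (node S B) with treeHeight B ≤? suc (treeHeight S)
... | yes _ = leaf , S , B
... | no  _ = map₁ (node S) (mark B)

treeHeight-recombine : ∀ A Q R → Marked (A , Q , R) → treeHeight (recombine (A , Q , R)) ≡ suc (treeHeight Q)
treeHeight-recombine A Q R (hA≤hQ , hR≤1+hQ) = begin
  treeHeight (A ⊕ node Q R)                          ≡⟨ treeHeight-⊕ A (node Q R) ⟩
  treeHeight A ⊔ (suc (treeHeight Q) ⊔ treeHeight R) ≡⟨ cong (treeHeight A ⊔_) (m≥n⇒m⊔n≡m hR≤1+hQ) ⟩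
  treeHeight A ⊔ suc (treeHeight Q)                  ≡⟨ m≤n⇒m⊔n≡n (m≤n⇒m≤1+n hA≤hQ) ⟩
  suc (treeHeight Q)                                 ∎
  where open ≡-Reasoning

recombine-mark : ∀ S B → recombine (mark (node S B)) ≡ node S B
recombine-mark S B with treeHeight B ≤? suc (treeHeight S)
... | yes _ = refl
recombine-mark S leaf         | no ¬hB≤1+hS = ⊥-elim (¬hB≤1+hS z≤n)
recombine-mark S (node S′ B′) | no _         = cong (node S) (recombine-mark S′ B′)

mark-marked : ∀ t → Marked (mark t)
mark-marked leaf = z≤n , z≤n
mark-marked (node S B) with treeHeight B ≤? suc (treeHeight S)
... | yes hB≤1+hS = z≤n , hB≤1+hS
mark-marked (node S leaf)           | no ¬hB≤1+hS = ⊥-elim (¬hB≤1+hS z≤n)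
mark-marked (node S B@(node S′ B′)) | no ¬hB≤1+hS
  with mark B | mark-marked B | recombine-mark S′ B′
... | A , Q , R | hA≤hQ , hR≤1+hQ | B≡ = ⊔-lub 1+hS≤hQ hA≤hQ , hR≤1+hQ
  where
  hB≡1+hQ : treeHeight B ≡ suc (treeHeight Q)
  hB≡1+hQ = trans (cong treeHeight (sym B≡)) (treeHeight-recombine A Q R (hA≤hQ , hR≤1+hQ))
  1+hS≤hQ : suc (treeHeight S) ≤ treeHeight Q
  1+hS≤hQ = s≤s⁻¹ (subst (suc (suc (treeHeight S)) ≤_) hB≡1+hQ (≰⇒> ¬hB≤1+hS))

mark-recombine : ∀ A Q R → Marked (A , Q , R) → mark (recombine (A , Q , R)) ≡ (A , Q , R)
mark-recombine leaf Q R (_ , hR≤1+hQ) with treeHeight R ≤? suc (treeHeight Q)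
... | yes _       = refl
... | no ¬hR≤1+hQ = ⊥-elim (¬hR≤1+hQ hR≤1+hQ)
mark-recombine (node S A) Q R marked
  with 1+hS≤hQ , marked′ ← Marked-node S A Q R marked
     | treeHeight (A ⊕ node Q R) ≤? suc (treeHeight S)
... | yes h≤1+hS = ⊥-elim (<⇒≱ (s≤s 1+hS≤hQ)
                    (subst (_≤ suc (treeHeight S)) (treeHeight-recombine A Q R marked′) h≤1+hS))
... | no _       = cong (map₁ (node S)) (mark-recombine A Q R marked′)

Marked⇔ : ∀ A Q R → Marked (A , Q , R) ⇔ (treeHeight (node A R) ≤ suc (treeHeight Q))
Marked⇔ A Q R = mk⇔
  (λ (hA≤hQ , hR≤1+hQ) → ⊔-lub (s≤s hA≤hQ) hR≤1+hQ)
  (λ h → s≤s⁻¹ (m⊔n≤o⇒m≤o (suc (treeHeight A)) (treeHeight R) h)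
        , m⊔n≤o⇒n≤o (suc (treeHeight A)) (treeHeight R) h)

size-recombine : ∀ A Q R → size (recombine (A , Q , R)) ≡ size (node A R) + size Q
size-recombine A Q R = trans (size-⊕ A (node Q R)) (regroup (size A) (size Q) (size R))
  where
  regroup : ∀ a q r → a + suc (q + r) ≡ suc (a + r) + q
  regroup = solve-∀

split : Tree → Tree × Tree
split t = let A , Q , R = mark t in node A R , Q

join : Tree → Tree → Tree
join leaf       Q = leaf
join (node A R) Q = recombine (A , Q , R)

split-height : ∀ t → treeHeight (proj₁ (split t)) ≤ suc (treeHeight (proj₂ (split t)))
split-height t with mark t | mark-marked t
... | A , Q , R | marked = Equivalence.to (Marked⇔ A Q R) marked

join-split : ∀ t → 1 ≤ size t → uncurry join (split t) ≡ t
join-split (node S B) _ = recombine-mark S B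

size-join : ∀ P Q → 1 ≤ size P → size (join P Q) ≡ size P + size Q
size-join (node A R) Q _ = size-recombine A Q R

split-join : ∀ P Q → 1 ≤ size P → treeHeight P ≤ suc (treeHeight Q) → split (join P Q) ≡ (P , Q)
split-join (node A R) Q _ h =
  cong (λ (A , Q , R) → node A R , Q) (mark-recombine A Q R (Equivalence.from (Marked⇔ A Q R) h))

size-split : ∀ t → 1 ≤ size t → size (proj₁ (split t)) + size (proj₂ (split t)) ≡ size t
size-split t 1≤∣t∣ = begin
  size (proj₁ (split t)) + size (proj₂ (split t)) ≡⟨ size-join (proj₁ (split t)) _ (s≤s z≤n) ⟨
  size (uncurry join (split t))                   ≡⟨ cong size (join-split t 1≤∣t∣) ⟩
  size t                                          ∎
  where open ≡-Reasoning

firstPath secondPath : ∀ {n} → GoodPair n → List Step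
firstPath  (_ , _ , _ , (p , _) , _) = p
secondPath (_ , _ , _ , _ , (q , _) , _) = q

GoodPair-ext : ∀ {n} (x y : GoodPair n) → firstPath x ≡ firstPath y → secondPath x ≡ secondPath y → x ≡ y
GoodPair-ext (a  , b  , e  , (p  , lp  , dp)  , (q  , lq  , dq)  , o  , h)
             (a′ , b′ , e′ , (.p , lp′ , dp′) , (.q , lq′ , dq′) , o′ , h′) refl refl
  with refl ← *-cancelˡ-≡ a a′ 2 (trans (sym lp) lp′)
     | refl ← *-cancelˡ-≡ b b′ 2 (trans (sym lq) lq′)
  rewrite ≡-irrelevant e e′ | ≡-irrelevant lp lp′ | ≡-irrelevant lq lq′
        | Bool-≡-irrelevant dp dp′ | Bool-≡-irrelevant dq dq′
        | ≤-irrelevant o o′ | ≤-irrelevant h h′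
  = refl

module _ (n : ℕ) (1≤n : 1 ≤ n) where

  toGoodPair : DyckPath n → GoodPair n
  toGoodPair (s , isDyck) = size P , size Q , sizes , dyckPathOf P , dyckPathOf Q , s≤s z≤n , heights
    where
    t = pathTree s
    P = proj₁ (split t)
    Q = proj₂ (split t)
    sizes : size P + size Q ≡ n
    sizes = trans (size-split t (1≤size-pathTree n s isDyck 1≤n)) (size-pathTree n s isDyck)
    heights : height (toPath P) ≤ suc (height (toPath Q))
    heights = subst₂ (λ x y → x ≤ suc y) (sym (height-toPath P)) (sym (height-toPath Q)) (split-height t)

  fromGoodPair : GoodPair n → DyckPath n
  fromGoodPair (a , b , a+b≡n , (p , isDyckP) , (q , isDyckQ) , 1≤a , _) = toPath R , length-R , dyckFrom-toPath R
    where
    P = pathTree p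
    Q = pathTree q
    R = join P Q
    length-R : length (toPath R) ≡ 2 * n
    length-R = begin
      length (toPath R)      ≡⟨ length-toPath R ⟩
      2 * size R             ≡⟨ cong (2 *_) (size-join P Q (1≤size-pathTree a p isDyckP 1≤a)) ⟩
      2 * (size P + size Q)  ≡⟨ cong₂ (λ x y → 2 * (x + y)) (size-pathTree a p isDyckP) (size-pathTree b q isDyckQ) ⟩
      2 * (a + b)            ≡⟨ cong (2 *_) a+b≡n ⟩
      2 * n                  ∎
      where open ≡-Reasoning

  fromGoodPair-toGoodPair : ∀ x → fromGoodPair (toGoodPair x) ≡ x
  fromGoodPair-toGoodPair (s , isDyck) = BallotPath-ext 0 (2 * n) (begin
    toPath (join (pathTree (toPath P)) (pathTree (toPath Q)))
      ≡⟨ cong₂ (λ x y → toPath (join x y)) (pathTree-toPath P) (pathTree-toPath Q) ⟩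
    toPath (join P Q)
      ≡⟨ cong toPath (join-split t (1≤size-pathTree n s isDyck 1≤n)) ⟩
    toPath t
      ≡⟨ toPath-pathTree s (proj₂ isDyck) ⟩
    s
      ∎)
    where
    open ≡-Reasoning
    t = pathTree s
    P = proj₁ (split t)
    Q = proj₂ (split t)

  toGoodPair-fromGoodPair : ∀ y → toGoodPair (fromGoodPair y) ≡ y
  toGoodPair-fromGoodPair y@(a , _ , _ , (p , isDyckP) , (q , isDyckQ) , 1≤a , h) =
    GoodPair-ext (toGoodPair (fromGoodPair y)) y
      (trans (cong (λ x → toPath (proj₁ x)) split≡) (toPath-pathTree p (proj₂ isDyckP)))
      (trans (cong (λ x → toPath (proj₂ x)) split≡) (toPath-pathTree q (proj₂ isDyckQ)))
    where
    P = pathTree p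
    Q = pathTree q
    hP≤1+hQ : treeHeight P ≤ suc (treeHeight Q)
    hP≤1+hQ = subst₂ (λ x y → x ≤ suc y)
      (sym (height-pathTree p (proj₂ isDyckP))) (sym (height-pathTree q (proj₂ isDyckQ))) h
    split≡ : split (pathTree (toPath (join P Q))) ≡ (P , Q)
    split≡ = trans (cong split (pathTree-toPath (join P Q)))
      (split-join P Q (1≤size-pathTree a p isDyckP 1≤a) hP≤1+hQ)

  DyckPath↔GoodPair : DyckPath n ↔ GoodPair n
  DyckPath↔GoodPair = mk↔ₛ′ toGoodPair fromGoodPair toGoodPair-fromGoodPair fromGoodPair-toGoodPair

lemma2p1 : (n : ℕ) → 1 ≤ n → Fin (catalan n) ↔ GoodPair n
lemma2p1 n 1≤n = ↔-trans (Fin-catalan↔DyckPath n) (DyckPath↔GoodPair n 1≤n)
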